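{- Let $P$ be a finite set of constrained Horn clauses, and suppose the oracle $\mathrm{SOLVE\_LINEAR}$ is sound (whenever it returns a solution $S$ for a set of linear clauses $L$, $S$ is a solution of $L$). If the procedure $\mathrm{SOLVE}(P)$ below returns $(\mathit{solved}, S)$, then $P$ is solvable and the interpretation obtained from $S$ by erasing the dimension indices of the predicates is a solution of $P$. Procedure $\mathrm{SOLVE}(P)$: set $k\gets 0$ and $P'\gets P^{\le 0}$. Repeat: $(r_k,S_k)\gets \mathrm{SOLVE\_LINEAR}(P')$; if $r_k\ne \mathit{solved}$ return $\mathit{unknown}$; if $\mathrm{INDUCTIVE}(S_k,P)=\text{yes}$ return $(\mathit{solved},S_k)$; otherwise set $P_{k+1}\gets P^{\le k+1}$, $PL_{k+1}\gets \mathrm{LINEARIZE}(P_{k+1},S_k)$, $k\gets k+1$, $P'\gets PL_{k+1}$.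
   Context: A constrained Horn clause (CHC) has the form $p(X) \leftarrow \mathcal{C}, p_1(X_1),\ldots,p_m(X_m)$ with $m \ge 0$, where $\mathcal{C}$ is a conjunction of constraints in some background theory, $X, X_i$ are vectors of variables and $p, p_i$ are predicate symbols; the head may also be the special atom $\mathsf{false}$, always interpreted as false. A clause is linear if $m\le 1$. A solution of a set of CHCs is a set of constrained facts $p(X)\leftarrow\mathcal{C}(X)$ (the interpretation of $p$ being the disjunction of the constraints of its facts) that satisfies every clause; the set is solvable if it has a solution. The at-most-$k$-dimension program $P^{\le k}$ uses, for each predicate $H$ of $P$ and $d\in\{0,\ldots,k\}$, indexed predicates $H^{=d}$ and $H^{\le d}$, and consists of: (1) $H^{=0}\leftarrow\mathcal{C}$ for each $H\leftarrow\mathcal{C}$ in $P$; $H^{=d}\leftarrow\mathcal{C},B_1^{=d}$ ($0\le d\le k$) for each $H\leftarrow\mathcal{C},B_1$ in $P$; (2) for each $H\leftarrow\mathcal{C},B_1,\ldots,B_r$ in $P$ with $r>1$: (a) for $1\le d\le k$, $1\le j\le r$, the clause $H^{=d}\leftarrow\mathcal{C},Z_1,\ldots,Z_r$ with $Z_j=B_j^{=d}$ and $Z_i=B_i^{\le d-1}$ for $i\ne j$; (b) for $1\le d\le k$ and $J\subseteq\{1,\ldots,r\}$, $|J|=2$, the clause $H^{=d}\leftarrow\mathcal{C},Z_1,\ldots,Z_r$ with $Z_i=B_i^{=d-1}$ ($i\in J$), $Z_i=B_i^{\le d-2}$ ($i\notin J$), included only if all $Z_i$ are defined; (3) $H^{\le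 d}\leftarrow H^{=e}$ for $0\le d\le k$, $0\le e\le d$. $\mathrm{LINEARIZE}(Q,M)$ replaces, in every clause of $Q$, each body atom $p(Y)$ whose predicate has a constrained fact $p(X)\leftarrow\mathcal{C}_p(X)$ in $M$ by the constraint $\mathcal{C}_p(Y)$. $\mathrm{INDUCTIVE}(M,P)$: let $M'$ be obtained from $M$ by removing the index from every predicate in each constrained fact (so $H^{=d}$ and $H^{\le d}$ become $H$); it returns yes iff $M'$ is a solution of $P$, and no otherwise. -}

module Defs where

open import Data.Nat using (ℕ; zero; suc; _≤_; _≡ᵇ_)
open import Data.Nat.Properties using () renaming (_≟_ to _≟ℕ_)
open import Data.Bool using (Bool; true; false; if_then_else_)
open import Data.List using (List; []; _∷_; [_]; map; length; upTo; concatMap; zipWith; filter; _++_)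
open import Data.List.Relation.Unary.All using (All)
open import Data.List.Relation.Unary.Any using (Any; any?)
open import Data.Maybe using (Maybe; just; nothing; maybe)
open import Data.Product using (_×_; _,_; ∃; Σ)
open import Data.Unit using (⊤)
open import Data.Empty using (⊥)
open import Data.Sum using (_⊎_)
open import Relation.Nullary using (Dec; yes; no; ¬?; does)
open import Relation.Binary.PropositionalEquality using (_≡_; refl; cong₂)
open import Relation.Binary.Definitions using (DecidableEquality)

Var : Set
Var = ℕ

Sym : Set
Sym = ℕ

Assign : Set → Set
Assign V = Var → V

Constraint : Set → Set₁
Constraint V = Assign V → Set

record Atom (A : Set) : Set where
  constructor _⟨_⟩
  field
    pred : A
    args : List Var
open Atom public

data Head (A : Set) : Set where
  falseH : Head A
  atomH  : Atom A → Head A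

record Clause (V : Set) (A : Set) : Set₁ where
  constructor _⇐_∣_
  field
    head   : Head A
    constr : Constraint V
    body   : List (Atom A)
open Clause public

CHCs : Set → Set → Set₁
CHCs V A = List (Clause V A)

Linear : {V A : Set} → Clause V A → Set
Linear c = length (body c) ≤ 1

LinearSet : {V A : Set} → CHCs V A → Set₁
LinearSet L = All Linear L

record Fact (V : Set) (A : Set) : Set₁ where
  constructor fact
  field
    fpred  : A
    fargs  : List Var
    fconstr : Constraint V
open Fact public

Interp : Set → Set → Set₁
Interp V A = List (Fact V A)

-- p holds of the tuple vs iff some fact p(X) ← C of M has an assignment σ
-- with σ(X) = vs and σ ⊨ C  (disjunction of the constraints of the facts;
-- variables of C outside X are existentially quantified)
HoldsIn : {V A : Set} → Interp V A → A → List V → Set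
HoldsIn []      p vs = ⊥
HoldsIn (f ∷ M) p vs = ((fpred f ≡ p) × (∃ λ σ → (map σ (fargs f) ≡ vs) × fconstr f σ)) ⊎ HoldsIn M p vs

AtomHolds : {V A : Set} → Interp V A → Assign V → Atom A → Set
AtomHolds M σ a = HoldsIn M (pred a) (map σ (args a))

HeadHolds : {V A : Set} → Interp V A → Assign V → Head A → Set
HeadHolds M σ falseH    = ⊥
HeadHolds M σ (atomH a) = AtomHolds M σ a

Satisfies : {V A : Set} → Interp V A → Clause V A → Set
Satisfies M c = ∀ σ → constr c σ → All (AtomHolds M σ) (body c) → HeadHolds M σ (head c)

IsSolution : {V A : Set} → Interp V A → CHCs V A → Set₁
IsSolution M P = All (Satisfies M) P

Solvable : {V A : Set} → CHCs V A → Set₁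
Solvable {V} {A} P = Σ (Interp V A) λ M → IsSolution M P

data IPred : Set where
  eqI : Sym → ℕ → IPred
  leI : Sym → ℕ → IPred

_≟I_ : DecidableEquality IPred
eqI h d ≟I eqI h' d' with h ≟ℕ h' | d ≟ℕ d'
... | yes refl | yes refl = yes refl
... | no ne    | _        = no λ { refl → ne refl }
... | yes _    | no ne    = no λ { refl → ne refl }
eqI _ _ ≟I leI _ _ = no λ ()
leI _ _ ≟I eqI _ _ = no λ ()
leI h d ≟I leI h' d' with h ≟ℕ h' | d ≟ℕ d'
... | yes refl | yes refl = yes refl
... | no ne    | _        = no λ { refl → ne refl }
... | yes _    | no ne    = no λ { refl → ne refl }

erasePred : IPred → Sym
erasePred (eqI h _) = h
erasePred (leI h _) = h

eraseInterp : {V : Set} → Interp V IPred → Interp V Sym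
eraseInterp = map (λ f → fact (erasePred (fpred f)) (fargs f) (fconstr f))

eqA : ℕ → Atom Sym → Atom IPred
eqA d (h ⟨ xs ⟩) = eqI h d ⟨ xs ⟩

leA : ℕ → Atom Sym → Atom IPred
leA d (h ⟨ xs ⟩) = leI h d ⟨ xs ⟩

headEq : ℕ → Head Sym → Head IPred
headEq d falseH    = falseH
headEq d (atomH a) = atomH (eqA d a)

allJust : {A : Set} → List (Maybe A) → Maybe (List A)
allJust [] = just []
allJust (nothing ∷ _) = nothing
allJust (just x ∷ xs) = maybe (λ ys → just (x ∷ ys)) nothing (allJust xs)

-- positions are 0-based: body atom i is the (i+1)-th atom
dimClauses : {V : Set} → ℕ → Clause V Sym → List (Clause V IPred)
dimClauses k (h ⇐ C ∣ []) = [ headEq 0 h ⇐ C ∣ [] ]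
dimClauses k (h ⇐ C ∣ (b ∷ [])) =
  map (λ d → headEq d h ⇐ C ∣ [ eqA d b ]) (upTo (suc k))
dimClauses {V} k (h ⇐ C ∣ bs@(_ ∷ _ ∷ _)) = typeA ++ typeB
  where
  r : ℕ
  r = length bs
  -- (2a): d = suc d' ranges over 1..k, j over the r positions
  typeA : List (Clause V IPred)
  typeA = concatMap (λ d' → map (λ j →
            headEq (suc d') h ⇐ C ∣
              zipWith (λ i b → if i ≡ᵇ j then eqA (suc d') b else leA d' b) (upTo r) bs)
          (upTo r)) (upTo k)
  -- two-element subsets J = {j₁ , j₂}, j₁ < j₂
  pairs : List (ℕ × ℕ)
  pairs = concatMap (λ j₂ → map (λ j₁ → (j₁ , j₂)) (upTo j₂)) (upTo r)
  -- Z_i for d = suc d' : B_i^{=d-1} if i ∈ J, B_i^{≤d-2} otherwise (undefined if d < 2)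
  zB : ℕ → ℕ → ℕ → ℕ → Atom Sym → Maybe (Atom IPred)
  zB d' j₁ j₂ i b = if (i ≡ᵇ j₁) Data.Bool.∨ (i ≡ᵇ j₂) then just (eqA d' b)
                    else (case d' of λ { zero → nothing ; (suc d'') → just (leA d'' b) })
    where open import Function using (case_of_)
  typeB : List (Clause V IPred)
  typeB = concatMap (λ d' → concatMap (λ { (j₁ , j₂) →
            maybe (λ zs → [ headEq (suc d') h ⇐ C ∣ zs ]) []
                  (allJust (zipWith (zB d' j₁ j₂) (upTo r) bs)) }) pairs) (upTo k)

occurrences : {V : Set} → CHCs V Sym → List (Sym × ℕ)
occurrences = concatMap (λ c → headOcc (head c) ++ map (λ a → (pred a , length (args a))) (body c))
  where
  headOcc : Head Sym → List (Sym × ℕ)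
  headOcc falseH = []
  headOcc (atomH a) = [ (pred a , length (args a)) ]

-- (3): H^{≤d}(X) ← H^{=e}(X) for 0 ≤ e ≤ d ≤ k, with X = (0,…,n-1)
leClauses : {V : Set} → ℕ → Sym × ℕ → List (Clause V IPred)
leClauses k (H , n) = concatMap (λ d → map (λ e →
    atomH (leI H d ⟨ upTo n ⟩) ⇐ (λ _ → ⊤) ∣ [ eqI H e ⟨ upTo n ⟩ ])
  (upTo (suc d))) (upTo (suc k))

dimProgram : {V : Set} → ℕ → CHCs V Sym → CHCs V IPred
dimProgram k P = concatMap (dimClauses k) P ++ concatMap (leClauses k) (occurrences P)

hasFact? : {V : Set} (M : Interp V IPred) (a : Atom IPred) → Dec (Any (λ f → fpred f ≡ pred a) M)
hasFact? M a = any? (λ f → fpred f ≟I pred a) M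

-- each body atom p(Y) whose predicate has facts in M is replaced by the
-- constraint C_p(Y) (semantically: the disjunction over the facts of p)
linearizeClause : {V : Set} → Interp V IPred → Clause V IPred → Clause V IPred
linearizeClause M (h ⇐ C ∣ bs) =
  h ⇐ (λ σ → C σ × All (AtomHolds M σ) (filter (hasFact? M) bs)) ∣ filter (λ a → ¬? (hasFact? M a)) bs

linearize : {V : Set} → CHCs V IPred → Interp V IPred → CHCs V IPred
linearize Q M = map (linearizeClause M) Q

data Status : Set where
  solved unknown unsat : Status

SolveLinear : Set → Set₁
SolveLinear V = CHCs V IPred → Status × Interp V IPred

SoundSolveLinear : {V : Set} → SolveLinear V → Set₁
SoundSolveLinear {V} solveLin =
  (L : CHCs V IPred) → LinearSet L → (S : Interp V IPred) →
  solveLin L ≡ (solved , S) → IsSolution S L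

SolutionDecider : Set → Set₁
SolutionDecider V = (M : Interp V Sym) (P : CHCs V Sym) → Dec (IsSolution M P)

INDUCTIVE : {V : Set} → SolutionDecider V → Interp V IPred → CHCs V Sym → Bool
INDUCTIVE dec M P = does (dec (eraseInterp M) P)

data Outcome (V : Set) : Set₁ where
  solvedO  : Interp V IPred → Outcome V
  unknownO : Outcome V

-- SOLVE(P), run for at most `fuel` iterations of the loop
-- (nothing = has not returned within the fuel)
module Procedure {V : Set} (solveLin : SolveLinear V) (dec : SolutionDecider V) (P : CHCs V Sym) where

  loop : ℕ → ℕ → CHCs V IPred → Maybe (Outcome V)
  step : ℕ → ℕ → Status × Interp V IPred → Maybe (Outcome V)

  loop zero    k P' = nothing
  loop (suc n) k P' = step n k (solveLin P')

  step n k (solved , S) =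
    if INDUCTIVE dec S P then just (solvedO S)
    else loop n (suc k) (linearize (dimProgram (suc k) P) S)
  step n k (unknown , S) = just unknownO
  step n k (unsat , S)   = just unknownO

  SOLVE : ℕ → Maybe (Outcome V)
  SOLVE fuel = loop fuel 0 (dimProgram 0 P)

SOLVEReturnsSolved : {V : Set} → SolveLinear V → SolutionDecider V → CHCs V Sym → Interp V IPred → Set₁
SOLVEReturnsSolved solveLin dec P S = ∃ λ fuel → Procedure.SOLVE solveLin dec P fuel ≡ just (solvedO S)

module Submission where

open import Defs
open import Data.Product using (_×_; _,_)
open import Data.Maybe using (just)
open import Data.Nat using (ℕ; zero; suc)
open import Relation.Nullary using (yes; no)
open import Relation.Binary.PropositionalEquality using (_≡_; refl)

-- SOLVE returns (solved, S) only after INDUCTIVE has accepted S, so the index-erased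
-- S is a solution of P because the decider says so.

solution⇒solvable : {V A : Set} {M : Interp V A} {P : CHCs V A} → IsSolution M P → Solvable P
solution⇒solvable {M = M} sol = M , sol

module _ {V : Set} (solveLin : SolveLinear V) (dec : SolutionDecider V) (P : CHCs V Sym) where
  open Procedure solveLin dec P

  loop-solved⇒solution : ∀ n k (P′ : CHCs V IPred) (S : Interp V IPred) →
                         loop n k P′ ≡ just (solvedO S) → IsSolution (eraseInterp S) P
  step-solved⇒solution : ∀ n k (r : Status × Interp V IPred) (S : Interp V IPred) →
                         step n k r ≡ just (solvedO S) → IsSolution (eraseInterp S) P

  loop-solved⇒solution zero    k P′ S ()
  loop-solved⇒solution (suc n) k P′ S eq = step-solved⇒solution n k (solveLin P′) S eq

  step-solved⇒solution n k (solved , S′) S eq with dec (eraseInterp S′) P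
  step-solved⇒solution n k (solved , S′) .S′ refl | yes S′-solves = S′-solves
  ... | no _ = loop-solved⇒solution n (suc k) _ S eq
  step-solved⇒solution n k (unknown , _) S ()
  step-solved⇒solution n k (unsat   , _) S ()

  SOLVE-solved⇒solution : ∀ fuel (S : Interp V IPred) →
                          SOLVE fuel ≡ just (solvedO S) → IsSolution (eraseInterp S) P
  SOLVE-solved⇒solution fuel = loop-solved⇒solution fuel 0 (dimProgram 0 P)

proposition1 : {V : Set} (solveLin : SolveLinear V) (dec : SolutionDecider V)
               (P : CHCs V Sym) → SoundSolveLinear solveLin →
               (S : Interp V IPred) → SOLVEReturnsSolved solveLin dec P S →
               Solvable P × IsSolution (eraseInterp S) P
proposition1 solveLin dec P _ S (fuel , returns-solved) =
  solution⇒solvable S-solves , S-solves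
  where
  S-solves : IsSolution (eraseInterp S) P
  S-solves = SOLVE-solved⇒solution solveLin dec P fuel S returns-solved
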